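{- Let $r\ge 6$ be an integer not divisible by $3$. Then there exists a bipartite graph $G$ on $2r+6$ vertices with diameter $3$, with stable sets of sizes $6$ and $2r$, in which every vertex of the set of size $2r$ has degree $3$ and every vertex of the set of size $6$ has degree in $\{r-1,r,r+1\}$. Moreover, if $r\equiv 2\pmod 3$, there exists a bipartite biregular graph with degrees $r$ and $3$ and diameter $3$ on $2r+6$ vertices (which equals the Moore bound $M(r,3;3)=2r+6$ for such $r$).
   Context: A bipartite graph with stable sets $V_1,V_2$ is biregular with degrees $a,b$ if all vertices of $V_1$ have degree $a$ and all vertices of $V_2$ have degree $b$. For $r>3$ with $3\nmid r$, the Moore-like bound on the order of a bipartite biregular graph with degrees $r,3$ and diameter $3$ is $M(r,3;3)=\lfloor (3r-2)/r\rfloor (r+3)=2r+6$. -}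

module Defs where

open import Data.Nat using (ℕ; zero; suc; _+_; _<_)
open import Data.Fin using (Fin; zero; suc)
open import Data.Bool using (Bool; true; false; if_then_else_; not)
open import Data.Product using (Σ; _×_; ∃₂)
open import Relation.Binary.PropositionalEquality using (_≡_; _≢_)
open import Relation.Nullary using (¬_)

record Graph (n : ℕ) : Set where
  field
    adj    : Fin n → Fin n → Bool
    adj-sym : ∀ u v → adj u v ≡ adj v u
    irrefl : ∀ v → adj v v ≡ false
open Graph public

count : ∀ {n} → (Fin n → Bool) → ℕ
count {zero}  f = 0
count {suc n} f = (if f zero then 1 else 0) + count (λ i → f (suc i))

degree : ∀ {n} → Graph n → Fin n → ℕ
degree G v = count (adj G v)

-- Within G k u v : there is a walk from u to v of length at most k,
-- i.e. dist(u,v) ≤ k.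
data Within {n} (G : Graph n) : ℕ → Fin n → Fin n → Set where
  here : ∀ {k v} → Within G k v v
  step : ∀ {k u w v} → adj G u w ≡ true → Within G k w v → Within G (suc k) u v

HasDiameter : ∀ {n} → Graph n → ℕ → Set
HasDiameter {n} G d =
  (∀ u v → Within G d u v) ×
  ∃₂ (λ (u v : Fin n) → ∀ k → k < d → ¬ Within G k u v)

-- A bipartition of G into two stable sets:
-- V₁ = {v | side v ≡ false}, V₂ = {v | side v ≡ true}.
IsBipartition : ∀ {n} → Graph n → (Fin n → Bool) → Set
IsBipartition {n} G side = ∀ (u v : Fin n) → adj G u v ≡ true → side u ≢ side v

size₁ : ∀ {n} → (Fin n → Bool) → ℕ
size₁ side = count (λ v → not (side v))

size₂ : ∀ {n} → (Fin n → Bool) → ℕ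
size₂ side = count side

BiregularBipartite : ∀ {n} → Graph n → ℕ → ℕ → Set
BiregularBipartite {n} G a b =
  Σ (Fin n → Bool) λ side →
    IsBipartition G side ×
    (∀ v → side v ≡ false → degree G v ≡ a) ×
    (∀ v → side v ≡ true → degree G v ≡ b)

-- The graphs are incidence graphs of multisets of 2r triples of a 6-set.
-- Two triples of a 6-set are disjoint only if they are complementary, and the
-- seven triples 012, 013, 045, 145, 234, 235, 034 contain no complementary pair,
-- so any two blocks are at distance 2. The first six of them cover every pair of
-- points, so any two points are at distance 2 once these six all occur; hence
-- every distance is at most 3, and by parity a point outside a triple is at
-- distance exactly 3 from it. These six triples also contain every point exactly
-- three times: writing r = c + 3s with c ∈ {1, 2}, we take them s times together
-- with 2c further triples, namely 012, 013 (points then lie on r + 1, r or r − 1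
-- triples) or 012, 034, 145, 235 (every point then lies on exactly r triples).
module Submission where

open import Defs
open import Data.Nat using (ℕ; zero; suc; _+_; _*_; _∸_; _≤_; _<_; s≤s) renaming (_≟_ to _≟ℕ_)
open import Data.Nat.Divisibility using (_∣_; m%n≡0⇒n∣m)
open import Data.Nat.DivMod using (_%_; _/_; m≡m%n+[m/n]*n; m%n<n; [m+kn]%n≡m%n)
open import Data.Nat.Properties using (+-assoc; +-comm; +-identityʳ)
open import Data.Nat.Tactic.RingSolver using (solve-∀)
open import Data.Fin using (Fin; zero; suc; _↑ˡ_; _↑ʳ_; splitAt; _≟_)
open import Data.Fin.Patterns using (0F; 1F; 2F; 3F; 4F; 5F; 6F)
open import Data.Fin.Properties using (splitAt⁻¹-↑ˡ; splitAt⁻¹-↑ʳ; all?; any?)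
open import Data.Vec.Functional using (Vector; []; _∷_; _++_; map)
open import Data.Vec.Functional.Properties using (lookup-++ˡ; lookup-++ʳ)
open import Data.Bool using (Bool; true; false; if_then_else_; not; _∨_)
open import Data.Bool.Properties using (¬-not) renaming (_≟_ to _≟ᵇ_)
open import Data.Product using (Σ; _×_; _,_; ∃-syntax)
open import Data.Sum using (_⊎_; inj₁; inj₂)
open import Function using (_∘_)
open import Relation.Binary.PropositionalEquality
  using (_≡_; _≢_; refl; sym; trans; cong; cong₂; cong-app; subst; ≢-sym)
open import Relation.Nullary using (¬_; contradiction)
open import Relation.Nullary.Decidable using (⌊_⌋; from-yes; _×-dec_; _⊎-dec_)

private
  variable
    A : Set
    m n : ℕ

count-cong : {f g : Fin n → Bool} → (∀ i → f i ≡ g i) → count f ≡ count g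
count-cong {zero}  f≗g = refl
count-cong {suc n} f≗g =
  cong₂ (λ b k → (if b then 1 else 0) + k) (f≗g zero) (count-cong (f≗g ∘ suc))

count-false : count {n} (λ _ → false) ≡ 0
count-false {zero}  = refl
count-false {suc n} = count-false {n}

count-true : count {n} (λ _ → true) ≡ n
count-true {zero}  = refl
count-true {suc n} = cong suc (count-true {n})

count-split : ∀ m (f : Fin (m + n) → Bool) →
              count f ≡ count (λ i → f (i ↑ˡ n)) + count (λ j → f (m ↑ʳ j))
count-split zero    f = refl
count-split (suc m) f =
  trans (cong ((if f zero then 1 else 0) +_) (count-split m (f ∘ suc)))
        (sym (+-assoc (if f zero then 1 else 0) _ _))

count-map-++ : (f : A → Bool) (xs : Vector A m) (ys : Vector A n) →
               count (map f (xs ++ ys)) ≡ count (map f xs) + count (map f ys)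
count-map-++ {m = m} f xs ys =
  trans (count-split m (map f (xs ++ ys)))
        (cong₂ _+_ (count-cong (cong f ∘ lookup-++ˡ xs ys))
                   (count-cong (cong f ∘ lookup-++ʳ xs ys)))

repeat : ∀ q → Vector A m → Vector A (q * m)
repeat zero    xs = []
repeat (suc q) xs = xs ++ repeat q xs

count-map-repeat : (f : A → Bool) (q : ℕ) (xs : Vector A m) →
                   count (map f (repeat q xs)) ≡ q * count (map f xs)
count-map-repeat f zero    xs = refl
count-map-repeat f (suc q) xs =
  trans (count-map-++ f xs (repeat q xs))
        (cong (count (map f xs) +_) (count-map-repeat f q xs))

module _ {G : Graph n} where

  within-suc : ∀ {k u v} → Within G k u v → Within G (suc k) u v
  within-suc here       = here
  within-suc (step e w) = step e (within-suc w)

  -- A walk of length 2 returns to the side it started from.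
  bipartite-no-short-walk : ∀ {side} → IsBipartition G side →
    ∀ {u v} → side u ≢ side v → adj G u v ≡ false →
    ∀ {k} → k < 3 → ¬ Within G k u v
  bipartite-no-short-walk bip sides≢ _ _ here = sides≢ refl
  bipartite-no-short-walk bip _ nonadj _ (step e here) with trans (sym nonadj) e
  ... | ()
  bipartite-no-short-walk bip {u} {v} sides≢ _ _ (step {w = w} e (step e′ here)) =
    sides≢ (trans (¬-not (bip u w e)) (sym (¬-not (≢-sym (bip w v e′)))))
  bipartite-no-short-walk bip _ _ (s≤s (s≤s (s≤s ()))) (step _ (step _ (step _ _)))

-- The incidence graph of a family of b blocks on p points, given by its incidence
-- matrix N (N B x ≡ true iff x ∈ B); blocks come first among the vertices.
module IncidenceGraph {b p : ℕ} (N : Fin b → Fin p → Bool) where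

  blockRow : Fin b → Fin (b + p) → Bool
  blockRow B = (λ _ → false) ++ N B

  pointRow : Fin p → Fin (b + p) → Bool
  pointRow x = (λ B → N B x) ++ (λ _ → false)

  adjacency : Fin (b + p) → Fin (b + p) → Bool
  adjacency = blockRow ++ pointRow

  isBlock : Fin (b + p) → Bool
  isBlock = (λ (_ : Fin b) → true) ++ (λ (_ : Fin p) → false)

  adjacency-block : ∀ B → adjacency (B ↑ˡ p) ≡ blockRow B
  adjacency-block = lookup-++ˡ blockRow pointRow

  adjacency-point : ∀ x → adjacency (b ↑ʳ x) ≡ pointRow x
  adjacency-point = lookup-++ʳ blockRow pointRow

  module _ (B : Fin b) (x : Fin p) where

    adjacency-block-point : adjacency (B ↑ˡ p) (b ↑ʳ x) ≡ N B x
    adjacency-block-point =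
      trans (cong-app (adjacency-block B) (b ↑ʳ x)) (lookup-++ʳ (λ (_ : Fin b) → false) (N B) x)

    adjacency-point-block : adjacency (b ↑ʳ x) (B ↑ˡ p) ≡ N B x
    adjacency-point-block =
      trans (cong-app (adjacency-point x) (B ↑ˡ p)) (lookup-++ˡ (λ B → N B x) (λ _ → false) B)

  adjacency-block-block : ∀ B C → adjacency (B ↑ˡ p) (C ↑ˡ p) ≡ false
  adjacency-block-block B C =
    trans (cong-app (adjacency-block B) (C ↑ˡ p)) (lookup-++ˡ (λ _ → false) (N B) C)

  adjacency-point-point : ∀ x y → adjacency (b ↑ʳ x) (b ↑ʳ y) ≡ false
  adjacency-point-point x y =
    trans (cong-app (adjacency-point x) (b ↑ʳ y)) (lookup-++ʳ (λ B → N B x) (λ _ → false) y)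

  data Vertex : Fin (b + p) → Set where
    block : ∀ B → Vertex (B ↑ˡ p)
    point : ∀ x → Vertex (b ↑ʳ x)

  vertex : ∀ v → Vertex v
  vertex v with splitAt b v in eq
  ... | inj₁ B = subst Vertex (splitAt⁻¹-↑ˡ eq) (block B)
  ... | inj₂ x = subst Vertex (splitAt⁻¹-↑ʳ eq) (point x)

  adjacency-sym : ∀ u v → adjacency u v ≡ adjacency v u
  adjacency-sym u v with vertex u | vertex v
  ... | block B | block C =
    trans (adjacency-block-block B C) (sym (adjacency-block-block C B))
  ... | block B | point x =
    trans (adjacency-block-point B x) (sym (adjacency-point-block B x))
  ... | point x | block B =
    trans (adjacency-point-block B x) (sym (adjacency-block-point B x))
  ... | point x | point y =
    trans (adjacency-point-point x y) (sym (adjacency-point-point y x))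

  adjacency-irrefl : ∀ v → adjacency v v ≡ false
  adjacency-irrefl v with vertex v
  ... | block B = adjacency-block-block B B
  ... | point x = adjacency-point-point x x

  incidenceGraph : Graph (b + p)
  incidenceGraph = record
    { adj = adjacency ; adj-sym = adjacency-sym ; irrefl = adjacency-irrefl }

  isBlock-block : ∀ B → isBlock (B ↑ˡ p) ≡ true
  isBlock-block = lookup-++ˡ (λ (_ : Fin b) → true) (λ (_ : Fin p) → false)

  isBlock-point : ∀ x → isBlock (b ↑ʳ x) ≡ false
  isBlock-point = lookup-++ʳ (λ (_ : Fin b) → true) (λ (_ : Fin p) → false)

  isBlock-bipartition : IsBipartition incidenceGraph isBlock
  isBlock-bipartition u v adjacent sides≡ with vertex u | vertex v
  ... | block B | block C with trans (sym (adjacency-block-block B C)) adjacent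
  ... | ()
  isBlock-bipartition u v adjacent sides≡ | block B | point x
    with trans (sym (isBlock-block B)) (trans sides≡ (isBlock-point x))
  ... | ()
  isBlock-bipartition u v adjacent sides≡ | point x | block B
    with trans (sym (isBlock-point x)) (trans sides≡ (isBlock-block B))
  ... | ()
  isBlock-bipartition u v adjacent sides≡ | point x | point y
    with trans (sym (adjacency-point-point x y)) adjacent
  ... | ()

  size₁-isBlock : size₁ isBlock ≡ p
  size₁-isBlock =
    trans (count-map-++ {m = b} {n = p} not (λ _ → true) (λ _ → false))
          (trans (cong (_+ count {p} (λ _ → true)) (count-false {b})) (count-true {p}))

  size₂-isBlock : size₂ isBlock ≡ b
  size₂-isBlock =
    trans (count-map-++ {m = b} {n = p} (λ β → β) (λ _ → true) (λ _ → false))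
          (trans (cong₂ _+_ (count-true {b}) (count-false {p})) (+-identityʳ b))

  degree-block : ∀ B → degree incidenceGraph (B ↑ˡ p) ≡ count (N B)
  degree-block B =
    trans (cong count (adjacency-block B))
          (trans (count-map-++ {m = b} (λ β → β) (λ _ → false) (N B))
                 (cong (_+ count (N B)) (count-false {b})))

  degree-point : ∀ x → degree incidenceGraph (b ↑ʳ x) ≡ count (λ B → N B x)
  degree-point x =
    trans (cong count (adjacency-point x))
          (trans (count-map-++ {n = p} (λ β → β) (λ B → N B x) (λ _ → false))
                 (trans (cong (count (λ B → N B x) +_) (count-false {p})) (+-identityʳ _)))

  blocks-degree : (P : ℕ → Set) → (∀ B → P (count (N B))) →
                  ∀ v → isBlock v ≡ true → P (degree incidenceGraph v)
  blocks-degree P P-size v isBlock-v with vertex v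
  ... | block B = subst P (sym (degree-block B)) (P-size B)
  ... | point x with trans (sym (isBlock-point x)) isBlock-v
  ... | ()

  points-degree : (P : ℕ → Set) → (∀ x → P (count (λ B → N B x))) →
                  ∀ v → isBlock v ≡ false → P (degree incidenceGraph v)
  points-degree P P-count v isPoint-v with vertex v
  ... | point x = subst P (sym (degree-point x)) (P-count x)
  ... | block B with trans (sym (isBlock-block B)) isPoint-v
  ... | ()

  module _ (covers : ∀ x y → ∃[ B ] N B x ≡ true × N B y ≡ true)
           (meets  : ∀ B C → ∃[ x ] N B x ≡ true × N C x ≡ true) where

    points-within-2 : ∀ x y → Within incidenceGraph 2 (b ↑ʳ x) (b ↑ʳ y)
    points-within-2 x y with covers x y
    ... | B , x∈B , y∈B =
      step (trans (adjacency-point-block B x) x∈B)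
           (step (trans (adjacency-block-point B y) y∈B) here)

    blocks-within-2 : ∀ B C → Within incidenceGraph 2 (B ↑ˡ p) (C ↑ˡ p)
    blocks-within-2 B C with meets B C
    ... | x , x∈B , x∈C =
      step (trans (adjacency-block-point B x) x∈B)
           (step (trans (adjacency-point-block C x) x∈C) here)

    within-3 : ∀ u v → Within incidenceGraph 3 u v
    within-3 u v with vertex u | vertex v
    ... | block B | block C = within-suc (blocks-within-2 B C)
    ... | point x | point y = within-suc (points-within-2 x y)
    ... | block B | point y with meets B B
    ... | x , x∈B , _ =
      step (trans (adjacency-block-point B x) x∈B) (points-within-2 x y)
    within-3 u v | point x | block C with covers x x
    ... | B , x∈B , _ =
      step (trans (adjacency-point-block B x) x∈B) (blocks-within-2 B C)

    diameter-3 : ∀ B x → N B x ≡ false → HasDiameter incidenceGraph 3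
    diameter-3 B x x∉B =
      within-3 , b ↑ʳ x , B ↑ˡ p ,
      λ k k<3 → bipartite-no-short-walk isBlock-bipartition
                  (λ sides≡ → contradiction (trans (sym (isBlock-point x))
                                                   (trans sides≡ (isBlock-block B))) λ ())
                  (trans (adjacency-point-block B x) x∉B) k<3

Diameter3Bipartite : ℕ → (ℕ → Set) → Set
Diameter3Bipartite b D =
  Σ (Graph (b + 6)) λ G → Σ (Fin (b + 6) → Bool) λ side →
    IsBipartition G side × HasDiameter G 3 ×
    size₁ side ≡ 6 × size₂ side ≡ b ×
    (∀ v → side v ≡ true → degree G v ≡ 3) ×
    (∀ v → side v ≡ false → D (degree G v))

biregular : ∀ {b a} → Diameter3Bipartite b (_≡ a) →
            Σ (Graph (b + 6)) λ G → BiregularBipartite G a 3 × HasDiameter G 3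
biregular (G , side , bip , diam , _ , _ , deg₂ , deg₁) =
  G , (side , bip , deg₁ , deg₂) , diam

⟦_,_,_⟧ : Fin 6 → Fin 6 → Fin 6 → Fin 6 → Bool
⟦ a , b , c ⟧ x = ⌊ x ≟ a ⌋ ∨ ⌊ x ≟ b ⌋ ∨ ⌊ x ≟ c ⌋

triple : Fin 7 → Fin 6 → Bool
triple = ⟦ 0F , 1F , 2F ⟧ ∷ ⟦ 0F , 1F , 3F ⟧ ∷ ⟦ 0F , 4F , 5F ⟧ ∷ ⟦ 1F , 4F , 5F ⟧ ∷
         ⟦ 2F , 3F , 4F ⟧ ∷ ⟦ 2F , 3F , 5F ⟧ ∷ ⟦ 0F , 3F , 4F ⟧ ∷ []

occurrences : Vector (Fin 7) m → Fin 6 → ℕ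
occurrences σ x = count (λ i → triple (σ i) x)

period : Vector (Fin 7) 6
period = 0F ∷ 1F ∷ 2F ∷ 3F ∷ 4F ∷ 5F ∷ []

triple-size : ∀ t → count (triple t) ≡ 3
triple-size = from-yes (all? λ t → count (triple t) ≟ℕ 3)

triples-meet : ∀ s t → ∃[ x ] triple s x ≡ true × triple t x ≡ true
triples-meet = from-yes (all? λ s → all? λ t → any? λ x →
                 (triple s x ≟ᵇ true) ×-dec (triple t x ≟ᵇ true))

period-covers : ∀ x y → ∃[ j ] triple (period j) x ≡ true × triple (period j) y ≡ true
period-covers = from-yes (all? λ x → all? λ y → any? λ j →
                  (triple (period j) x ≟ᵇ true) ×-dec (triple (period j) y ≟ᵇ true))

period-occurrences : ∀ x → occurrences period x ≡ 3
period-occurrences = from-yes (all? λ x → occurrences period x ≟ℕ 3)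

module TripleSystem {c : ℕ} (prefix : Vector (Fin 7) c) (q : ℕ) where

  blocks : Vector (Fin 7) (c + suc q * 6)
  blocks = prefix ++ repeat (suc q) period

  blocks-period : ∀ j → blocks (c ↑ʳ (j ↑ˡ q * 6)) ≡ period j
  blocks-period j = trans (lookup-++ʳ prefix _ (j ↑ˡ q * 6)) (lookup-++ˡ period _ j)

  occurrences-blocks : ∀ x → occurrences blocks x ≡ occurrences prefix x + suc q * 3
  occurrences-blocks x =
    trans (count-map-++ (λ t → triple t x) prefix (repeat (suc q) period))
          (cong (occurrences prefix x +_)
                (trans (count-map-repeat (λ t → triple t x) (suc q) period)
                       (cong (suc q *_) (period-occurrences x))))

  open IncidenceGraph (λ B → triple (blocks B))

  blocks-cover : ∀ x y → ∃[ B ] triple (blocks B) x ≡ true × triple (blocks B) y ≡ true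
  blocks-cover x y with period-covers x y
  ... | j , x∈ , y∈ =
    c ↑ʳ (j ↑ˡ q * 6) ,
    subst (λ t → triple t x ≡ true × triple t y ≡ true) (sym (blocks-period j)) (x∈ , y∈)

  tripleSystemGraph : (D : ℕ → Set) → (∀ x → D (occurrences prefix x + suc q * 3)) →
                      Diameter3Bipartite (c + suc q * 6) D
  tripleSystemGraph D D-occurrences =
    incidenceGraph , isBlock , isBlock-bipartition ,
    diameter-3 blocks-cover (λ B C → triples-meet (blocks B) (blocks C))
               (c ↑ʳ (3F ↑ˡ q * 6)) 0F (cong (λ t → triple t 0F) (blocks-period 3F)) ,
    size₁-isBlock , size₂-isBlock ,
    blocks-degree (_≡ 3) (triple-size ∘ blocks) ,
    points-degree D (λ x → subst D (sym (occurrences-blocks x)) (D-occurrences x))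

prefix₁ : Vector (Fin 7) 2
prefix₁ = 0F ∷ 1F ∷ []

prefix₁-occurrences : ∀ x → occurrences prefix₁ x ≡ 0 ⊎ occurrences prefix₁ x ≡ 1 ⊎
                            occurrences prefix₁ x ≡ 2
prefix₁-occurrences = from-yes (all? λ x → let k = occurrences prefix₁ x in
  (k ≟ℕ 0) ⊎-dec (k ≟ℕ 1) ⊎-dec (k ≟ℕ 2))

prefix₂ : Vector (Fin 7) 4
prefix₂ = 0F ∷ 6F ∷ 3F ∷ 5F ∷ []

prefix₂-occurrences : ∀ x → occurrences prefix₂ x ≡ 2
prefix₂-occurrences = from-yes (all? λ x → occurrences prefix₂ x ≟ℕ 2)

residue-1-or-2 : ∀ r → 6 ≤ r → ¬ 3 ∣ r →
                 (∃[ q ] r ≡ 1 + suc q * 3) ⊎ (∃[ q ] r ≡ 2 + suc q * 3)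
residue-1-or-2 r 6≤r 3∤r =
  cases (r % 3) (r / 3) (m≡m%n+[m/n]*n r 3) (m%n<n r 3) (3∤r ∘ m%n≡0⇒n∣m r 3)
  where
  cases : ∀ c q → r ≡ c + q * 3 → c < 3 → c ≢ 0 →
          (∃[ q ] r ≡ 1 + suc q * 3) ⊎ (∃[ q ] r ≡ 2 + suc q * 3)
  cases 0 _ _ _ c≢0 = contradiction refl c≢0
  cases 1 (suc q) eq _ _ = inj₁ (q , eq)
  cases 2 (suc q) eq _ _ = inj₂ (q , eq)
  cases 1 zero eq _ _ = contradiction (subst (6 ≤_) eq 6≤r) λ { (s≤s ()) }
  cases 2 zero eq _ _ = contradiction (subst (6 ≤_) eq 6≤r) λ { (s≤s (s≤s ())) }
  cases (suc (suc (suc _))) _ _ (s≤s (s≤s (s≤s ()))) _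

OffByAtMostOne : ℕ → ℕ → Set
OffByAtMostOne r d = d ≡ r ∸ 1 ⊎ d ≡ r ⊎ d ≡ r + 1

blocks≡2r : ∀ c s → 2 * c + s * 6 ≡ 2 * (c + s * 3)
blocks≡2r = solve-∀

tripleSystemGraph-2r : ∀ c (prefix : Vector (Fin 7) (2 * c)) q (D : ℕ → Set) →
                       (∀ x → D (occurrences prefix x + suc q * 3)) →
                       Diameter3Bipartite (2 * (c + suc q * 3)) D
tripleSystemGraph-2r c prefix q D D-occurrences =
  subst (λ b → Diameter3Bipartite b D) (blocks≡2r c (suc q))
        (TripleSystem.tripleSystemGraph prefix q D D-occurrences)

proposition5p2 : (r : ℕ) → 6 ≤ r → ¬ (3 ∣ r) →
    (Σ (Graph (2 * r + 6)) λ G → Σ (Fin (2 * r + 6) → Bool) λ side →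
        IsBipartition G side × HasDiameter G 3 ×
        size₁ side ≡ 6 × size₂ side ≡ 2 * r ×
        (∀ v → side v ≡ true → degree G v ≡ 3) ×
        (∀ v → side v ≡ false →
          (degree G v ≡ r ∸ 1 ⊎ degree G v ≡ r ⊎ degree G v ≡ r + 1)))
    ×
    (r % 3 ≡ 2 →
      Σ (Graph (2 * r + 6)) λ G → BiregularBipartite G r 3 × HasDiameter G 3)
proposition5p2 r 6≤r 3∤r with residue-1-or-2 r 6≤r 3∤r
... | inj₁ (q , refl) =
  tripleSystemGraph-2r 1 prefix₁ q (OffByAtMostOne (1 + s)) (off-by-one ∘ prefix₁-occurrences) ,
  λ r%3≡2 → contradiction (trans (sym ([m+kn]%n≡m%n 1 (suc q) 3)) r%3≡2) λ ()
  where
  s = suc q * 3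
  off-by-one : ∀ {k} → k ≡ 0 ⊎ k ≡ 1 ⊎ k ≡ 2 → OffByAtMostOne (1 + s) (k + s)
  off-by-one (inj₁ refl)        = inj₁ refl
  off-by-one (inj₂ (inj₁ refl)) = inj₂ (inj₁ refl)
  off-by-one (inj₂ (inj₂ refl)) = inj₂ (inj₂ (sym (+-comm (1 + s) 1)))
... | inj₂ (q , refl) =
  tripleSystemGraph-2r 2 prefix₂ q (OffByAtMostOne (2 + suc q * 3))
                       (λ x → inj₂ (inj₁ (degree-r x))) ,
  λ _ → biregular (tripleSystemGraph-2r 2 prefix₂ q (_≡ 2 + suc q * 3) degree-r)
  where
  degree-r : ∀ x → occurrences prefix₂ x + suc q * 3 ≡ 2 + suc q * 3
  degree-r x = cong (_+ suc q * 3) (prefix₂-occurrences x)
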